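{- Let $r\ge 2$ be an integer, let $G=(V,E)$ be a graph with $|V|=n$ for $n$ sufficiently large (in terms of $r$), and let $T\subset E^r$ be a set of $r$-tuples of edges. Then $V$ can be partitioned into disjoint sets $V_1,\ldots,V_r$, each of size $\lceil n/r\rceil$ or $\lfloor n/r \rfloor$, such that at least $c_r|T|$ of the tuples of $T$ consist only of edges each having both of its endpoints in the same part $V_j$ (different edges of a tuple may lie in different parts), where $c_r>0$ depends only on $r$. -}

module Defs where

open import Data.Nat using (ℕ; _+_; _∸_; NonZero)
open import Data.Nat.DivMod using (_/_)
open import Data.Bool using (Bool; true)
open import Data.Fin using (Fin; _<_)
open import Data.Fin.Properties using (_≟_)
open import Data.Product using (_×_; proj₁; proj₂)
open import Data.Sum using (_⊎_)
open import Data.List using (List; length; filter; allFin)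
open import Data.Vec using (Vec)
import Data.Vec.Relation.Unary.All as VAll
open import Relation.Binary.PropositionalEquality using (_≡_)
open import Relation.Nullary using (¬_)

record Graph (n : ℕ) : Set where
  field
    Adj    : Fin n → Fin n → Bool
    sym    : ∀ u v → Adj u v ≡ Adj v u
    irrefl : ∀ u → ¬ (Adj u u ≡ true)

-- An edge {u,v} is represented canonically as the ordered pair (u , v) with u < v.
EdgeRep : ℕ → Set
EdgeRep n = Fin n × Fin n

IsEdge : ∀ {n} → Graph n → EdgeRep n → Set
IsEdge G e = (proj₁ e < proj₂ e) × (Graph.Adj G (proj₁ e) (proj₂ e) ≡ true)

partSize : ∀ {n r} → (Fin n → Fin r) → Fin r → ℕ
partSize {n} f j = length (filter (λ v → f v ≟ j) (allFin n))

ceilDiv : (n r : ℕ) → .{{_ : NonZero r}} → ℕ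
ceilDiv n r = (n + (r ∸ 1)) / r

IsEquipartition : ∀ {n r} .{{_ : NonZero r}} → (Fin n → Fin r) → Set
IsEquipartition {n} {r} f = ∀ j → (partSize f j ≡ n / r) ⊎ (partSize f j ≡ ceilDiv n r)

Good : ∀ {n r k} → (Fin n → Fin r) → Vec (EdgeRep n) k → Set
Good f t = VAll.All (λ e → f (proj₁ e) ≡ f (proj₂ e)) t

good? : ∀ {n r k} (f : Fin n → Fin r) (t : Vec (EdgeRep n) k) → Relation.Nullary.Dec (Good f t)
good? f t = VAll.all? (λ e → f (proj₁ e) ≟ f (proj₂ e)) t

goodCount : ∀ {n r k} → (Fin n → Fin r) → List (Vec (EdgeRep n) k) → ℕ
goodCount f T = length (filter (good? f) T)

-- Cut the vertices 0, …, n - 1 into fewer than B = 4r² blocks of q = ⌊n / 2r²⌋ consecutive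
-- vertices, and record for each tuple the blocks of its 2r endpoints. There are at most
-- K = B^(2r) such patterns, so one of them is shared by at least |T| / K tuples. The blocks
-- of that pattern hold at most 2rq ≤ ⌊n / r⌋ vertices, so some equipartition puts all of
-- them into a single part, and then every edge of every tuple with that pattern lies in it.
module Submission where

open import Defs
open import Data.Bool using (Bool; true; false; T; if_then_else_; not; _∧_; _∨_)
open import Data.Bool.Properties using (T-≡; T-∨)
open import Data.Fin using (Fin; zero; suc; toℕ; fromℕ<; combine; quotient; remainder; funToFin; finToFun)
open import Data.Fin.Properties using (_≟_; toℕ-fromℕ<; toℕ<n; remQuot-combine; finToFun-funToFin)
open import Data.List using (List; []; _∷_; length; filter; tabulate)
open import Data.List.Properties using (tabulate-cong)
open import Data.List.Relation.Binary.Sublist.Propositional using (_⊆_; ⊆-refl)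
open import Data.List.Relation.Binary.Sublist.Propositional.Properties using (filter⁺; length-mono-≤)
open import Data.List.Relation.Unary.All using (All)
open import Data.List.Relation.Unary.Unique.Propositional using (Unique)
open import Data.Nat hiding (_≟_)
open import Data.Nat.Divisibility using (divides-refl)
open import Data.Nat.DivMod
open import Data.Nat.ListAction using (sum)
open import Data.Nat.Properties hiding (_≟_)
open import Data.Nat.Tactic.RingSolver using (solve-∀)
open import Data.Product using (Σ; ∃-syntax; _,_; _×_; proj₁; proj₂)
open import Data.Sum using (_⊎_; inj₁; inj₂)
open import Data.Vec using (Vec; []; _∷_; lookup)
import Data.Vec.Relation.Unary.All as VAll
open import Function using (_∘_; id)
open import Function.Bundles using (Equivalence)
open import Relation.Binary.PropositionalEquality
open import Relation.Nullary using (does; yes; no; contradiction)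
open import Relation.Unary using (Pred; Decidable)

n≡r*[n/r]+n%r : ∀ n r .{{_ : NonZero r}} → n ≡ r * (n / r) + n % r
n≡r*[n/r]+n%r n r = begin
  n                      ≡⟨ m≡m%n+[m/n]*n n r ⟩
  n % r + n / r * r      ≡⟨ +-comm (n % r) _ ⟩
  n / r * r + n % r      ≡⟨ cong (_+ n % r) (*-comm (n / r) r) ⟩
  r * (n / r) + n % r    ∎
  where open ≡-Reasoning

[m+kn]/n≡k : ∀ {m} k n .{{_ : NonZero n}} → m < n → (m + k * n) / n ≡ k
[m+kn]/n≡k {m} k n m<n = begin
  (m + k * n) / n        ≡⟨ +-distrib-/-∣ʳ m (divides-refl k) ⟩
  m / n + k * n / n      ≡⟨ cong₂ _+_ (m<n⇒m/n≡0 m<n) (m*n/n≡m k n) ⟩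
  k                      ∎
  where open ≡-Reasoning

ceilDiv≡1+/ : ∀ n r .{{_ : NonZero r}} → 0 < n % r → ceilDiv n r ≡ suc (n / r)
ceilDiv≡1+/ n r@(suc r′) 0<s = begin
  (n + r′) / r                              ≡⟨ cong (λ m → (m + r′) / r) (m≡m%n+[m/n]*n n r) ⟩
  (n % r + n / r * r + r′) / r              ≡⟨ cong (λ s → (s + n / r * r + r′) / r) (m+[n∸m]≡n 0<s) ⟨
  (suc (n % r ∸ 1) + n / r * r + r′) / r    ≡⟨ cong (_/ r) (regroup (n % r ∸ 1) (n / r) r′) ⟩
  (n % r ∸ 1 + suc (n / r) * r) / r         ≡⟨ [m+kn]/n≡k (suc (n / r)) r (≤-<-trans (m∸n≤m _ 1) (m%n<n n r)) ⟩
  suc (n / r)                               ∎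
  where
  open ≡-Reasoning
  regroup : ∀ a k r′ → suc a + k * suc r′ + r′ ≡ a + suc k * suc r′
  regroup = solve-∀

n<[d+d]*[n/d] : ∀ {n d} .{{_ : NonZero d}} → d ≤ n → n < (d + d) * (n / d)
n<[d+d]*[n/d] {n} {d} d≤n = begin-strict
  n                          ≡⟨ m≡m%n+[m/n]*n n d ⟩
  n % d + n / d * d          <⟨ +-monoˡ-< (n / d * d) (m%n<n n d) ⟩
  d + n / d * d              ≤⟨ +-monoˡ-≤ (n / d * d) (m≤n*m d (n / d) {{>-nonZero (m≥n⇒m/n>0 d≤n)}}) ⟩
  n / d * d + n / d * d      ≡⟨ regroup (n / d) d ⟩
  (d + d) * (n / d)          ∎
  where
  open ≤-Reasoning
  regroup : ∀ k d → k * d + k * d ≡ (d + d) * k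
  regroup = solve-∀

a*[n/[b*a]]≤n/b : ∀ n a b .{{_ : NonZero a}} .{{_ : NonZero b}} .{{_ : NonZero (b * a)}} →
                  a * (n / (b * a)) ≤ n / b
a*[n/[b*a]]≤n/b n a b = begin
  a * (n / (b * a))          ≡⟨ cong (a *_) (m/n/o≡m/[n*o] n b a) ⟨
  a * (n / b / a)            ≡⟨ *-comm a _ ⟩
  n / b / a * a              ≤⟨ m/n*n≤m (n / b) a ⟩
  n / b                      ∎
  where open ≤-Reasoning

toℕ-mod : ∀ {x r} .{{_ : NonZero r}} → x < r → toℕ (x mod r) ≡ x
toℕ-mod {x} {r} x<r = trans (toℕ-fromℕ< (m%n<n x r)) (m<n⇒m%n≡m x<r)

count : (ℕ → Bool) → ℕ → ℕ
count p zero    = 0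
count p (suc n) = if p 0 then suc (count (p ∘ suc) n) else count (p ∘ suc) n

count-cong : ∀ {p p′} n → (∀ i → i < n → p i ≡ p′ i) → count p n ≡ count p′ n
count-cong zero    eq = refl
count-cong (suc n) eq =
  cong₂ (λ b m → if b then suc m else m) (eq 0 z<s) (count-cong n (λ i → eq (suc i) ∘ s<s))

count-false : ∀ n → count (λ _ → false) n ≡ 0
count-false zero    = refl
count-false (suc n) = count-false n

count-true : ∀ n → count (λ _ → true) n ≡ n
count-true zero    = refl
count-true (suc n) = cong suc (count-true n)

count-+ : ∀ p m n → count p (m + n) ≡ count p m + count (λ i → p (m + i)) n
count-+ p zero    n = refl
count-+ p (suc m) n with p 0
... | true  = cong suc (count-+ (p ∘ suc) m n)
... | false = count-+ (p ∘ suc) m n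

count-mono : ∀ p {m n} → m ≤ n → count p m ≤ count p n
count-mono p {m} {n} m≤n = begin
  count p m                                    ≤⟨ m≤m+n _ _ ⟩
  count p m + count (λ i → p (m + i)) (n ∸ m)  ≡⟨ count-+ p m (n ∸ m) ⟨
  count p (m + (n ∸ m))                        ≡⟨ cong (count p) (m+[n∸m]≡n m≤n) ⟩
  count p n                                    ∎
  where open ≤-Reasoning

count-∨ : ∀ p p′ n → count (λ i → p i ∨ p′ i) n ≤ count p n + count p′ n
count-∨ p p′ zero = z≤n
count-∨ p p′ (suc n) with p 0 | p′ 0 | count-∨ (p ∘ suc) (p′ ∘ suc) n
... | true  | true  | ih = s≤s (≤-trans (m≤n⇒m≤1+n ih) (≤-reflexive (sym (+-suc _ _))))
... | true  | false | ih = s≤s ih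
... | false | true  | ih = ≤-trans (s≤s ih) (≤-reflexive (sym (+-suc _ _)))
... | false | false | ih = ih

count-complement : ∀ p n → count p n + count (not ∘ p) n ≡ n
count-complement p zero = refl
count-complement p (suc n) with p 0
... | true  = cong suc (count-complement (p ∘ suc) n)
... | false = trans (+-suc _ _) (cong suc (count-complement (p ∘ suc) n))

count-split : ∀ u p n → count p n ≡ count (λ i → u i ∧ p i) n + count (λ i → not (u i) ∧ p i) n
count-split u p zero = refl
count-split u p (suc n) with u 0 | p 0 | count-split (u ∘ suc) (p ∘ suc) n
... | true  | true  | ih = cong suc ih
... | true  | false | ih = ih
... | false | true  | ih = trans (cong suc ih) (sym (+-suc _ _))
... | false | false | ih = ih

count-< : ∀ u {i n} → T (u i) → i < n → count u i < count u n
count-< u {zero}  {suc n} ui _ with u 0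
... | true = s≤s z≤n
count-< u {suc i} {suc n} ui (s<s i<n) with u 0
... | true  = s<s (count-< (u ∘ suc) ui i<n)
... | false = count-< (u ∘ suc) ui i<n

count-≡ᵇ : ∀ j s → count (_≡ᵇ j) s ≡ (if j <ᵇ s then 1 else 0)
count-≡ᵇ j       zero    = refl
count-≡ᵇ zero    (suc s) = cong suc (count-false s)
count-≡ᵇ (suc j) (suc s) = count-≡ᵇ j s

module _ (q : ℕ) .{{_ : NonZero q}} where

  [q+x]/q≡1+x/q : ∀ x → (q + x) / q ≡ suc (x / q)
  [q+x]/q≡1+x/q x = trans (m/n≡1+[m∸n]/n (m≤m+n q x)) (cong (λ y → suc (y / q)) (m+n∸m≡n q x))

  count-block : ∀ k p → count (λ x → x / q ≡ᵇ p) (k * q) ≡ (if p <ᵇ k then q else 0)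
  count-block zero p = refl
  count-block (suc k) p = begin
    count (λ x → x / q ≡ᵇ p) (q + k * q)
      ≡⟨ count-+ _ q (k * q) ⟩
    count (λ x → x / q ≡ᵇ p) q + count (λ x → (q + x) / q ≡ᵇ p) (k * q)
      ≡⟨ cong₂ _+_ (count-cong q (λ x x<q → cong (_≡ᵇ p) (m<n⇒m/n≡0 x<q)))
                   (count-cong (k * q) (λ x _ → cong (_≡ᵇ p) ([q+x]/q≡1+x/q x))) ⟩
    count (λ _ → 0 ≡ᵇ p) q + count (λ x → suc (x / q) ≡ᵇ p) (k * q)
      ≡⟨ shifted p ⟩
    (if p <ᵇ suc k then q else 0) ∎
    where
    open ≡-Reasoning
    shifted : ∀ p → count (λ _ → 0 ≡ᵇ p) q + count (λ x → suc (x / q) ≡ᵇ p) (k * q)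
                  ≡ (if p <ᵇ suc k then q else 0)
    shifted zero    = trans (cong₂ _+_ (count-true q) (count-false (k * q))) (+-identityʳ q)
    shifted (suc p) = trans (cong (_+ count (λ x → x / q ≡ᵇ p) (k * q)) (count-false q)) (count-block k p)

  count-block-≤ : ∀ p n → count (λ x → x / q ≡ᵇ p) n ≤ q
  count-block-≤ p n = begin
    count (λ x → x / q ≡ᵇ p) n        ≤⟨ count-mono _ (m≤m*n n q) ⟩
    count (λ x → x / q ≡ᵇ p) (n * q)  ≡⟨ count-block n p ⟩
    (if p <ᵇ n then q else 0)         ≤⟨ bounded (p <ᵇ n) ⟩
    q                                 ∎
    where
    open ≤-Reasoning
    bounded : ∀ b → (if b then q else 0) ≤ q
    bounded true  = ≤-refl
    bounded false = z≤n

count-rank : ∀ u g n → count (λ i → u i ∧ g (count u i)) n ≡ count g (count u n)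
count-rank u g zero = refl
count-rank u g (suc n) with u 0
... | true  = cong (λ m → if g 0 then suc m else m) (count-rank (u ∘ suc) (g ∘ suc) n)
... | false = count-rank (u ∘ suc) g n

-- The position of i in the listing of 0, …, n - 1 that puts the members of u first,
-- each group in increasing order.
membersFirst : (ℕ → Bool) → ℕ → ℕ → ℕ
membersFirst u n i = if u i then count u i else count u n + count (not ∘ u) i

count-membersFirst : ∀ u g n → count (λ i → g (membersFirst u n i)) n ≡ count g n
count-membersFirst u g n = begin
  count (g ∘ membersFirst u n) n
    ≡⟨ count-split u (g ∘ membersFirst u n) n ⟩
  count (λ i → u i ∧ g (membersFirst u n i)) n + count (λ i → not (u i) ∧ g (membersFirst u n i)) n
    ≡⟨ cong₂ _+_ (count-cong n (λ i _ → member i)) (count-cong n (λ i _ → nonMember i)) ⟩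
  count (λ i → u i ∧ g (count u i)) n + count (λ i → not (u i) ∧ g′ (count (not ∘ u) i)) n
    ≡⟨ cong₂ _+_ (count-rank u g n) (count-rank (not ∘ u) g′ n) ⟩
  count g (count u n) + count g′ (count (not ∘ u) n)
    ≡⟨ count-+ g (count u n) _ ⟨
  count g (count u n + count (not ∘ u) n)
    ≡⟨ cong (count g) (count-complement u n) ⟩
  count g n ∎
  where
  open ≡-Reasoning
  g′ : ℕ → Bool
  g′ = g ∘ (count u n +_)
  member : ∀ i → (u i ∧ g (membersFirst u n i)) ≡ (u i ∧ g (count u i))
  member i with u i
  ... | true  = refl
  ... | false = refl
  nonMember : ∀ i → (not (u i) ∧ g (membersFirst u n i)) ≡ (not (u i) ∧ g′ (count (not ∘ u) i))
  nonMember i with u i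
  ... | true  = refl
  ... | false = refl

membersFirst-member : ∀ u n {i} → T (u i) → membersFirst u n i ≡ count u i
membersFirst-member u n {i} ui with u i
... | true = refl

length-filter-tabulate : ∀ {a p} {A : Set a} {P : Pred A p} (P? : Decidable P) {n} (h : Fin n → A)
                         (c : ℕ → Bool) → (∀ v → does (P? (h v)) ≡ c (toℕ v)) →
                         length (filter P? (tabulate h)) ≡ count c n
length-filter-tabulate P? {zero}  h c eq = refl
length-filter-tabulate P? {suc n} h c eq with does (P? (h zero)) | c 0 | eq zero
... | true  | .true  | refl = cong suc (length-filter-tabulate P? (h ∘ suc) (c ∘ suc) (eq ∘ suc))
... | false | .false | refl = length-filter-tabulate P? (h ∘ suc) (c ∘ suc) (eq ∘ suc)

does-≟ : ∀ {m} (a b : Fin m) → does (a ≟ b) ≡ (toℕ a ≡ᵇ toℕ b)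
does-≟ zero    zero    = refl
does-≟ zero    (suc b) = refl
does-≟ (suc a) zero    = refl
does-≟ (suc a) (suc b) = does-≟ a b

module Layout (r Q : ℕ) .{{_ : NonZero Q}} where

  layout : ℕ → ℕ
  layout x with x <? r * Q
  ... | yes _ = x / Q
  ... | no  _ = x ∸ r * Q

  layout-below : ∀ {x} → x < r * Q → layout x ≡ x / Q
  layout-below {x} x<rQ with x <? r * Q
  ... | yes _     = refl
  ... | no  x≮rQ = contradiction x<rQ x≮rQ

  layout-beyond : ∀ x → layout (r * Q + x) ≡ x
  layout-beyond x with r * Q + x <? r * Q
  ... | yes rQ+x<rQ = contradiction rQ+x<rQ (m+n≮m (r * Q) x)
  ... | no  _       = m+n∸m≡n (r * Q) x

  count-layout : ∀ s j → j < r →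
                 count (λ x → layout x ≡ᵇ j) (r * Q + s) ≡ Q + (if j <ᵇ s then 1 else 0)
  count-layout s j j<r = begin
    count (λ x → layout x ≡ᵇ j) (r * Q + s)
      ≡⟨ count-+ _ (r * Q) s ⟩
    count (λ x → layout x ≡ᵇ j) (r * Q) + count (λ x → layout (r * Q + x) ≡ᵇ j) s
      ≡⟨ cong₂ _+_ (count-cong (r * Q) (λ x x<rQ → cong (_≡ᵇ j) (layout-below x<rQ)))
                   (count-cong s (λ x _ → cong (_≡ᵇ j) (layout-beyond x))) ⟩
    count (λ x → x / Q ≡ᵇ j) (r * Q) + count (_≡ᵇ j) s
      ≡⟨ cong₂ _+_ (count-block Q r j) (count-≡ᵇ j s) ⟩
    (if j <ᵇ r then Q else 0) + (if j <ᵇ s then 1 else 0)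
      ≡⟨ cong (λ b → (if b then Q else 0) + (if j <ᵇ s then 1 else 0)) (Equivalence.to T-≡ (<⇒<ᵇ j<r)) ⟩
    Q + (if j <ᵇ s then 1 else 0) ∎
    where open ≡-Reasoning

  layout-< : ∀ {s x} → s ≤ r → x < r * Q + s → layout x < r
  layout-< {s} {x} s≤r x<n with x <? r * Q
  ... | yes x<rQ = m<n*o⇒m/o<n x<rQ
  ... | no  x≮rQ = <-≤-trans (<-≤-trans (∸-monoˡ-< x<n (≮⇒≥ x≮rQ)) (≤-reflexive (m+n∸m≡n (r * Q) s))) s≤r

  layout-initial : ∀ {x} → .{{NonZero r}} → x < Q → layout x ≡ 0
  layout-initial {x} x<Q = trans (layout-below (<-≤-trans x<Q (m≤n*m Q r))) (m<n⇒m/n≡0 x<Q)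

module Equipartition (n r : ℕ) .{{_ : NonZero r}} .{{_ : NonZero (n / r)}} (u : ℕ → Bool) where
  open Layout r (n / r)

  -- mod r never reduces here: it only moves the value of layout, already below r, into Fin r.
  partition : Fin n → Fin r
  partition v = layout (membersFirst u n (toℕ v)) mod r

  partSize-partition : ∀ j → partSize partition j ≡ n / r + (if toℕ j <ᵇ n % r then 1 else 0)
  partSize-partition j = begin
    partSize partition j
      ≡⟨ length-filter-tabulate (λ v → partition v ≟ j) id (g ∘ membersFirst u n) (λ _ → refl) ⟩
    count (g ∘ membersFirst u n) n
      ≡⟨ count-membersFirst u g n ⟩
    count g n
      ≡⟨ count-cong n (λ x x<n → does-mod (layout-< (<⇒≤ (m%n<n n r)) (subst (x <_) n≡ x<n))) ⟩
    count (λ x → layout x ≡ᵇ toℕ j) n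
      ≡⟨ cong (count (λ x → layout x ≡ᵇ toℕ j)) n≡ ⟩
    count (λ x → layout x ≡ᵇ toℕ j) (r * (n / r) + n % r)
      ≡⟨ count-layout (n % r) (toℕ j) (toℕ<n j) ⟩
    n / r + (if toℕ j <ᵇ n % r then 1 else 0) ∎
    where
    open ≡-Reasoning
    n≡ : n ≡ r * (n / r) + n % r
    n≡ = n≡r*[n/r]+n%r n r
    g : ℕ → Bool
    g x = does (layout x mod r ≟ j)
    does-mod : ∀ {x} → layout x < r → g x ≡ (layout x ≡ᵇ toℕ j)
    does-mod {x} lx<r = trans (does-≟ (layout x mod r) j) (cong (_≡ᵇ toℕ j) (toℕ-mod lx<r))

  isEquipartition : IsEquipartition partition
  isEquipartition j = subst (λ m → m ≡ n / r ⊎ m ≡ ceilDiv n r) (sym (partSize-partition j))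
                            (sizes (toℕ j <ᵇ n % r) (λ t → ≤-<-trans z≤n (<ᵇ⇒< (toℕ j) (n % r) t)))
    where
    sizes : ∀ b → (T b → 0 < n % r) →
            n / r + (if b then 1 else 0) ≡ n / r ⊎ n / r + (if b then 1 else 0) ≡ ceilDiv n r
    sizes true  0<s = inj₂ (trans (+-comm (n / r) 1) (sym (ceilDiv≡1+/ n r (0<s _))))
    sizes false _   = inj₁ (+-identityʳ (n / r))

  partition-member : count u n ≤ n / r → ∀ v → T (u (toℕ v)) → partition v ≡ 0 mod r
  partition-member u≤Q v uv = cong (_mod r) (begin
    layout (membersFirst u n (toℕ v))   ≡⟨ cong layout (membersFirst-member u n uv) ⟩
    layout (count u (toℕ v))     ≡⟨ layout-initial (<-≤-trans (count-< u uv (toℕ<n v)) u≤Q) ⟩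
    0                            ∎)
    where open ≡-Reasoning

max≥average : ∀ {M} .{{_ : NonZero M}} (c : Fin M → ℕ) → ∃[ i ] sum (tabulate c) ≤ M * c i
max≥average {1}           c = zero , ≤-refl
max≥average {suc (suc M)} c with max≥average (c ∘ suc)
... | i , S≤ with c zero ≤? c (suc i)
...   | yes c₀≤cᵢ = suc i , +-mono-≤ c₀≤cᵢ S≤
...   | no  c₀≰cᵢ = zero , +-monoʳ-≤ (c zero) (≤-trans S≤ (*-monoʳ-≤ (suc M) (≰⇒≥ c₀≰cᵢ)))

sum-tabulate-bump : ∀ {M} (j : Fin M) (c : Fin M → ℕ) →
                    sum (tabulate (λ i → if does (j ≟ i) then suc (c i) else c i)) ≡ suc (sum (tabulate c))
sum-tabulate-bump zero    c = refl
sum-tabulate-bump (suc j) c = trans (cong (c zero +_) (sum-tabulate-bump j (c ∘ suc))) (+-suc _ _)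

module _ {A : Set} where

  length-filter-∷ : ∀ {p} {P : Pred A p} (P? : Decidable P) x xs →
    length (filter P? (x ∷ xs)) ≡ (if does (P? x) then suc (length (filter P? xs)) else length (filter P? xs))
  length-filter-∷ P? x xs with does (P? x)
  ... | true  = refl
  ... | false = refl

  sum-classSizes : ∀ {M} (idx : A → Fin M) xs →
                   sum (tabulate (λ i → length (filter (λ x → idx x ≟ i) xs))) ≡ length xs
  sum-classSizes {M} idx [] = sum-zeros M
    where
    sum-zeros : ∀ M → sum (tabulate {n = M} (λ _ → 0)) ≡ 0
    sum-zeros zero    = refl
    sum-zeros (suc M) = sum-zeros M
  sum-classSizes idx (x ∷ xs) = begin
    sum (tabulate (λ i → length (filter (λ y → idx y ≟ i) (x ∷ xs))))
      ≡⟨ cong sum (tabulate-cong (λ i → length-filter-∷ (λ y → idx y ≟ i) x xs)) ⟩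
    sum (tabulate (λ i → if does (idx x ≟ i) then suc (classSize i) else classSize i))
      ≡⟨ sum-tabulate-bump (idx x) classSize ⟩
    suc (sum (tabulate classSize))
      ≡⟨ cong suc (sum-classSizes idx xs) ⟩
    suc (length xs) ∎
    where
    open ≡-Reasoning
    classSize : _ → ℕ
    classSize i = length (filter (λ y → idx y ≟ i) xs)

  pigeonhole : ∀ {M} .{{_ : NonZero M}} (idx : A → Fin M) xs →
               ∃[ i ] length xs ≤ M * length (filter (λ x → idx x ≟ i) xs)
  pigeonhole {M} idx xs with max≥average (λ i → length (filter (λ x → idx x ≟ i) xs))
  ... | i , bound = i , subst (_≤ M * length (filter (λ x → idx x ≟ i) xs)) (sum-classSizes idx xs) bound

module Blocks (n q B : ℕ) .{{_ : NonZero q}} (block-< : ∀ {x} → x < n → x / q < B) where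

  block : Fin n → Fin B
  block v = fromℕ< (block-< (toℕ<n v))

  edgeCode : EdgeRep n → Fin (B * B)
  edgeCode (a , b) = combine (block a) (block b)

  code : ∀ {k} → Vec (EdgeRep n) k → Fin ((B * B) ^ k)
  code t = funToFin (edgeCode ∘ lookup t)

  inBlock : Fin B → ℕ → Bool
  inBlock b x = x / q ≡ᵇ toℕ b

  hits : Fin (B * B) → ℕ → Bool
  hits e x = inBlock (quotient {B} B e) x ∨ inBlock (remainder {B} B e) x

  covered : ∀ {k} → (Fin k → Fin (B * B)) → ℕ → Bool
  covered {zero}  w x = false
  covered {suc k} w x = hits (w zero) x ∨ covered (w ∘ suc) x

  count-covered : ∀ {k} (w : Fin k → Fin (B * B)) → count (covered w) n ≤ (k + k) * q
  count-covered {zero}  w = ≤-reflexive (count-false n)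
  count-covered {suc k} w = begin
    count (covered w) n
      ≤⟨ count-∨ (hits (w zero)) (covered (w ∘ suc)) n ⟩
    count (hits (w zero)) n + count (covered (w ∘ suc)) n
      ≤⟨ +-monoˡ-≤ _ (count-∨ (inBlock a) (inBlock b) n) ⟩
    count (inBlock a) n + count (inBlock b) n + count (covered (w ∘ suc)) n
      ≤⟨ +-mono-≤ (+-mono-≤ (count-block-≤ q _ n) (count-block-≤ q _ n)) (count-covered (w ∘ suc)) ⟩
    q + q + (k + k) * q
      ≡⟨ regroup k q ⟩
    (suc k + suc k) * q ∎
    where
    open ≤-Reasoning
    a = quotient {B} B (w zero)
    b = remainder {B} B (w zero)
    regroup : ∀ k q → q + q + (k + k) * q ≡ (suc k + suc k) * q
    regroup = solve-∀

  covered-cong : ∀ {k} {w w′ : Fin k → Fin (B * B)} → (∀ i → w i ≡ w′ i) → ∀ x → covered w x ≡ covered w′ x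
  covered-cong {zero}  eq x = refl
  covered-cong {suc k} eq x = cong₂ (λ e c → hits e x ∨ c) (eq zero) (covered-cong (eq ∘ suc) x)

  inBlock-block : ∀ v → T (inBlock (block v) (toℕ v))
  inBlock-block v = ≡⇒≡ᵇ _ _ (sym (toℕ-fromℕ< (block-< (toℕ<n v))))

  hits-edgeCode : ∀ e → T (hits (edgeCode e) (toℕ (proj₁ e))) × T (hits (edgeCode e) (toℕ (proj₂ e)))
  hits-edgeCode (a , b) =
      subst T (sym (hits-combine (toℕ a))) (Equivalence.from T-∨ (inj₁ (inBlock-block a)))
    , subst T (sym (hits-combine (toℕ b))) (Equivalence.from T-∨ (inj₂ (inBlock-block b)))
    where
    hits-combine : ∀ x → hits (combine (block a) (block b)) x ≡ (inBlock (block a) x ∨ inBlock (block b) x)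
    hits-combine x = cong (λ p → inBlock (proj₁ p) x ∨ inBlock (proj₂ p) x) (remQuot-combine (block a) (block b))

  decode : ∀ k → Fin ((B * B) ^ k) → Fin k → Fin (B * B)
  decode k = finToFun {B * B} {k}

  CoversEdge : ∀ {k} → (Fin k → Fin (B * B)) → EdgeRep n → Set
  CoversEdge w (a , b) = T (covered w (toℕ a)) × T (covered w (toℕ b))

  covered-endpoints : ∀ {k} (t : Vec (EdgeRep n) k) → VAll.All (CoversEdge (edgeCode ∘ lookup t)) t
  covered-endpoints []             = VAll.[]
  covered-endpoints ((a , b) ∷ t) = now (hits-edgeCode (a , b)) VAll.∷ VAll.map (λ {e} → later e) (covered-endpoints t)
    where
    w = edgeCode ∘ lookup ((a , b) ∷ t)
    now : T (hits (w zero) (toℕ a)) × T (hits (w zero) (toℕ b)) → CoversEdge w (a , b)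
    now (ha , hb) = Equivalence.from T-∨ (inj₁ ha) , Equivalence.from T-∨ (inj₁ hb)
    later : ∀ e → CoversEdge (w ∘ suc) e → CoversEdge w e
    later (x , y) (cx , cy) = Equivalence.from T-∨ (inj₂ cx) , Equivalence.from T-∨ (inj₂ cy)

  decode-code-covers : ∀ {k} (t : Vec (EdgeRep n) k) → VAll.All (CoversEdge (decode k (code t))) t
  decode-code-covers {k} t = VAll.map (λ {e} → transport e) (covered-endpoints t)
    where
    same : ∀ z → covered (edgeCode ∘ lookup t) z ≡ covered (decode k (code t)) z
    same = covered-cong (λ i → sym (finToFun-funToFin (edgeCode ∘ lookup t) i))
    transport : ∀ e → CoversEdge (edgeCode ∘ lookup t) e → CoversEdge (decode k (code t)) e
    transport (x , y) (cx , cy) = subst T (same (toℕ x)) cx , subst T (same (toℕ y)) cy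

module Construction (r′ : ℕ) where

  r R B K : ℕ
  r = suc r′
  R = r * (r + r)
  B = R + R
  K = (B * B) ^ r

  instance
    K≢0 : NonZero K
    K≢0 = m^n≢0 (B * B) r

  goodPartition : ∀ n → R ≤ n → (T : List (Vec (EdgeRep n) r)) →
                  Σ (Fin n → Fin r) λ f → IsEquipartition f × length T ≤ K * goodCount f T
  goodPartition n R≤n T = partition , isEquipartition , (begin
    length T                                                ≤⟨ classBound ⟩
    K * length (filter (λ t → code t ≟ c) T)                ≤⟨ *-monoʳ-≤ K (length-mono-≤ classGood) ⟩
    K * goodCount partition T                               ∎)
    where
    open ≤-Reasoning
    q : ℕ
    q = n / R
    instance
      q≢0 : NonZero q
      q≢0 = >-nonZero (m≥n⇒m/n>0 R≤n)
    coverBound : (r + r) * q ≤ n / r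
    coverBound = a*[n/[b*a]]≤n/b n (r + r) r
    instance
      Q≢0 : NonZero (n / r)
      Q≢0 = >-nonZero (≤-trans (>-nonZero⁻¹ ((r + r) * q) {{m*n≢0 (r + r) q}}) coverBound)
    open Blocks n q B (λ x<n → m<n*o⇒m/o<n (<-trans x<n (n<[d+d]*[n/d] R≤n)))
    c : Fin K
    c = proj₁ (pigeonhole code T)
    classBound : length T ≤ K * length (filter (λ t → code t ≟ c) T)
    classBound = proj₂ (pigeonhole code T)
    open Equipartition n r (covered (decode r c))
    good : ∀ t → code t ≡ c → Good partition t
    good t eq = VAll.map (λ {e} → goodEdge e)
                  (subst (λ c′ → VAll.All (CoversEdge (decode r c′)) t) eq (decode-code-covers t))
      where
      U≤Q : count (covered (decode r c)) n ≤ n / r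
      U≤Q = ≤-trans (count-covered (decode r c)) coverBound
      goodEdge : ∀ e → CoversEdge (decode r c) e → partition (proj₁ e) ≡ partition (proj₂ e)
      goodEdge (a , b) (ua , ub) = trans (partition-member U≤Q a ua) (sym (partition-member U≤Q b ub))
    classGood : filter (λ t → code t ≟ c) T ⊆ filter (good? partition) T
    classGood = filter⁺ (λ t → code t ≟ c) (good? partition) (λ { refl → good _ }) (⊆-refl {x = T})

lemma2p5 : (r : ℕ) .{{_ : NonZero r}} → 2 ≤ r →
    Σ ℕ λ K → 1 ≤ K × Σ ℕ λ N → (n : ℕ) → N ≤ n → (G : Graph n) →
    (T : List (Vec (EdgeRep n) r)) → Unique T → All (VAll.All (IsEdge G)) T →
    Σ (Fin n → Fin r) λ f → IsEquipartition f × length T ≤ K * goodCount f T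
lemma2p5 (suc r′) _ = K , >-nonZero⁻¹ K , R , λ n R≤n _ T _ _ → goodPartition n R≤n T
  where open Construction r′
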